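{- Every graph of pathwidth $p$ has a simultaneous $p$-stack $p$-queue layout.
   Context: All graphs are finite, simple and undirected. A vertex order $\sigma$ is a total order of the vertices. Two edges $(u,v)$ and $(x,y)$ cross with respect to $\sigma$ if $u <_\sigma x <_\sigma v <_\sigma y$, and nest if $u <_\sigma x <_\sigma y <_\sigma v$. A simultaneous $s$-stack $q$-queue layout of $G$ is a single vertex order $\sigma$ together with a partition of $E(G)$ into $s$ sets of pairwise non-crossing edges and a partition of $E(G)$ into $q$ sets of pairwise non-nested edges, both with respect to $\sigma$. Pathwidth is the minimum width (maximum bag size minus one) of a path decomposition. -}

module Defs where

open import Data.Nat using (ℕ; suc; _≤_; _<_)
open import Data.Bool using (Bool; T; false)
open import Data.Fin using (Fin)
import Data.Fin as F
open import Data.Fin.Subset using (Subset; _∈_; ∣_∣)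
open import Data.Product using (Σ; ∃; _×_)
open import Relation.Binary.PropositionalEquality using (_≡_; _≢_)
open import Relation.Nullary using (¬_)
open import Function.Definitions using (Injective)

record Graph : Set where
  field
    n     : ℕ
    adj   : Fin n → Fin n → Bool
    sym   : ∀ u v → adj u v ≡ adj v u
    irref : ∀ u → adj u u ≡ false

  Edge : Fin n → Fin n → Set
  Edge u v = T (adj u v)

open Graph public

record PathDecomposition (G : Graph) : Set where
  field
    m     : ℕ
    bag   : Fin m → Subset (n G)
    cover-v : ∀ v → ∃ λ i → v ∈ bag i
    cover-e : ∀ u v → Edge G u v → ∃ λ i → (u ∈ bag i) × (v ∈ bag i)
    interval : ∀ v (i j k : Fin m) → i F.≤ j → j F.≤ k →
               v ∈ bag i → v ∈ bag k → v ∈ bag j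

open PathDecomposition public

WidthAtMost : {G : Graph} → PathDecomposition G → ℕ → Set
WidthAtMost D w = ∀ i → ∣ bag D i ∣ ≤ suc w

PathwidthAtMost : Graph → ℕ → Set
PathwidthAtMost G w = Σ (PathDecomposition G) λ D → WidthAtMost D w

HasPathwidth : Graph → ℕ → Set
HasPathwidth G p = PathwidthAtMost G p × (∀ q → q < p → ¬ PathwidthAtMost G q)

-- A vertex order σ, given as an injective (hence bijective) position map.
record VertexOrder (G : Graph) : Set where
  field
    pos    : Fin (n G) → Fin (n G)
    pos-inj : Injective _≡_ _≡_ pos

open VertexOrder public

_<[_]_ : {G : Graph} → Fin (n G) → VertexOrder G → Fin (n G) → Set
u <[ σ ] v = pos σ u F.< pos σ v

record EdgePartition (G : Graph) (k : ℕ) : Set where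
  field
    colour     : ∀ u v → Edge G u v → Fin k
    colour-sym : ∀ u v (e : Edge G u v) (e' : Edge G v u) →
                 colour u v e ≡ colour v u e'

open EdgePartition public

NonCrossing : {G : Graph} {k : ℕ} → VertexOrder G → EdgePartition G k → Set
NonCrossing {G} σ P =
  ∀ u v x y (e : Edge G u v) (f : Edge G x y) →
  u <[ σ ] x → x <[ σ ] v → v <[ σ ] y →
  colour P u v e ≢ colour P x y f

NonNested : {G : Graph} {k : ℕ} → VertexOrder G → EdgePartition G k → Set
NonNested {G} σ P =
  ∀ u v x y (e : Edge G u v) (f : Edge G x y) →
  u <[ σ ] x → x <[ σ ] y → y <[ σ ] v →
  colour P u v e ≢ colour P x y f

SimultaneousLayout : Graph → ℕ → ℕ → Set
SimultaneousLayout G s q =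
  Σ (VertexOrder G) λ σ →
    (Σ (EdgePartition G s) λ S → NonCrossing σ S) ×
    (Σ (EdgePartition G q) λ Q → NonNested σ Q)

-- Order the vertices by the first bag containing them (ties broken by index) and
-- colour every edge with the colour of its left end under a vertex colouring c.
-- If two edges uv and xy with u before x cross or nest, then u and x both lie in
-- the first bag of the successor z of x (the later vertex whose first bag comes
-- earliest).  So it suffices that c separates every x from the earlier vertices
-- sharing that bag with it.  The bag has at most p + 1 vertices, x and z among
-- them, so there are at most p − 1 such vertices and greedy colouring along the
-- order needs only p colours.
module Submission where

open import Defs hiding (sym)
open import Data.Nat using (ℕ; zero; suc; _≤_; _<_; z≤n; s≤s; _≤?_; _<?_)
open import Data.Nat.Properties
  using ( ≤-refl; ≤-trans; ≤-pred; ≤-reflexive; <-irrefl; <-asym; <-trans; <⇒≤; ≰⇒>; ≮⇒≥; <⇒≱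
        ; <-cmp; ≤∧≢⇒<; module ≤-Reasoning)
  renaming (_≟_ to _≟ℕ_)
open import Data.Bool using (T)
open import Data.Fin as F using (Fin; zero; suc; toℕ; fromℕ<; combine)
open import Data.Fin.Properties as FP
  using (any?; injective⇒≤; toℕ<n; toℕ-fromℕ<; toℕ-injective; combine-monoˡ-<; combine-injectiveʳ)
open import Data.Fin.Subset using (Subset; inside; outside; _∈_; _⊆_; _-_; ∣_∣; ⊤; ⊥)
open import Data.Fin.Subset.Properties
  using (_∈?_; ∈⊤; x∈p∧x≢y⇒x∈p-y; x∈p⇒∣p-x∣<∣p∣; ∣⊤∣≡n; ∣⊥∣≡0; p⊆q⇒∣p∣≤∣q∣; p⊂q⇒∣p∣<∣q∣)
open import Data.List using (List; []; _∷_; length; map)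
open import Data.List.Properties using (length-map)
open import Data.List.Membership.Propositional using () renaming (_∈_ to _∈ₗ_; _∉_ to _∉ₗ_)
open import Data.List.Membership.Propositional.Properties using (∈-map⁺)
open import Data.List.Membership.Setoid.Properties using (index-injective)
open import Data.List.Relation.Unary.Any as Any using (here; there; index)
open import Data.Vec using (tabulate; []; _∷_; here; there)
open import Data.Vec.Properties using (lookup∘tabulate; lookup⇒[]=; []=⇒lookup)
open import Data.Product using (∃; _×_; _,_; proj₁; proj₂)
open import Data.Empty using (⊥-elim)
open import Function using (_∘_)
open import Function.Definitions using (Injective)
open import Level using (Level)
open import Relation.Binary using (tri<; tri≈; tri>)
open import Relation.Binary.PropositionalEquality
  using (_≡_; _≢_; refl; sym; trans; cong; subst; setoid)
open import Relation.Nullary using (¬_; Dec; yes; no; does; ¬?; contradiction)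
open import Relation.Nullary.Decidable using (dec-true; decidable-stable; _×-dec_)
open import Relation.Unary using (Pred; Decidable)

private
  variable
    ℓ : Level

satisfying : ∀ {n} {P : Pred (Fin n) ℓ} → Decidable P → Subset n
satisfying P? = tabulate (does ∘ P?)

∈-satisfying⁺ : ∀ {n} {P : Pred (Fin n) ℓ} (P? : Decidable P) {x} → P x → x ∈ satisfying P?
∈-satisfying⁺ P? {x} px =
  lookup⇒[]= x _ (trans (lookup∘tabulate (does ∘ P?) x) (dec-true (P? x) px))

∈-satisfying⁻ : ∀ {n} {P : Pred (Fin n) ℓ} (P? : Decidable P) {x} → x ∈ satisfying P? → P x
∈-satisfying⁻ P? {x} x∈ with P? x | trans (sym (lookup∘tabulate (does ∘ P?) x)) ([]=⇒lookup x∈)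
... | yes px | _  = px
... | no  _  | ()

members : ∀ {n} → Subset n → List (Fin n)
members []            = []
members (inside  ∷ s) = zero ∷ map suc (members s)
members (outside ∷ s) = map suc (members s)

length-members : ∀ {n} (s : Subset n) → length (members s) ≡ ∣ s ∣
length-members []            = refl
length-members (inside  ∷ s) = cong suc (trans (length-map suc (members s)) (length-members s))
length-members (outside ∷ s) = trans (length-map suc (members s)) (length-members s)

∈-members : ∀ {n} {s : Subset n} {x} → x ∈ s → x ∈ₗ members s
∈-members                    here        = here refl
∈-members {s = inside  ∷ s} (there x∈s) = there (∈-map⁺ suc (∈-members x∈s))
∈-members {s = outside ∷ s} (there x∈s) = ∈-map⁺ suc (∈-members x∈s)

x,y∈p⇒2+∣p-x-y∣≤∣p∣ : ∀ {n} {p : Subset n} {x y} → x ∈ p → y ∈ p → x ≢ y →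
                      suc (suc ∣ p - x - y ∣) ≤ ∣ p ∣
x,y∈p⇒2+∣p-x-y∣≤∣p∣ x∈p y∈p x≢y =
  ≤-trans (s≤s (x∈p⇒∣p-x∣<∣p∣ (x∈p∧x≢y⇒x∈p-y y∈p (x≢y ∘ sym)))) (x∈p⇒∣p-x∣<∣p∣ x∈p)

length<⇒∃∉ : ∀ {k} (xs : List (Fin k)) → length xs < k → ∃ λ c → c ∉ₗ xs
length<⇒∃∉ {k} xs short with any? (λ c → ¬? (Any.any? (c FP.≟_) xs))
... | yes missing = missing
... | no ¬missing = contradiction (injective⇒≤ index-inj) (<⇒≱ short)
  where
  covered : ∀ c → c ∈ₗ xs
  covered c = decidable-stable (Any.any? (c FP.≟_) xs) (λ c∉ → ¬missing (c , c∉))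

  index-inj : Injective _≡_ _≡_ (λ c → index (covered c))
  index-inj {c} {c′} = index-injective (setoid (Fin k)) (covered c) (covered c′)

freshColour : ∀ {n k} (c : Fin n → Fin k) (s : Subset n) → ∣ s ∣ < k →
              ∃ λ colour → ∀ {a} → a ∈ s → c a ≢ colour
freshColour {k = k} c s small =
  let colour , colour∉ = length<⇒∃∉ (map c (members s)) short
  in colour , λ a∈s ca≡colour → colour∉ (subst (_∈ₗ _) ca≡colour (∈-map⁺ c (∈-members a∈s)))
  where
  short : length (map c (members s)) < k
  short = subst (_< k) (sym (trans (length-map c (members s)) (length-members s))) small

argmin : ∀ {n} {P : Pred (Fin n) ℓ} (f : Fin n → ℕ) → Decidable P → ∃ P →
         ∃ λ z → P z × (∀ y → P y → f z ≤ f y)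
argmin {n = suc _} f P? ∃P with any? (P? ∘ suc)
argmin f P? (zero  , p₀) | no ¬rest =
  zero , p₀ , λ { zero _ → ≤-refl ; (suc y) py → contradiction (y , py) ¬rest }
argmin f P? (suc i , pᵢ) | no ¬rest = contradiction (i , pᵢ) ¬rest
argmin f P? _ | yes rest with argmin (f ∘ suc) (P? ∘ suc) rest | P? zero
... | z , pz , min | no ¬p₀ =
  suc z , pz , λ { zero p₀ → contradiction p₀ ¬p₀ ; (suc y) py → min y py }
... | z , pz , min | yes p₀ with f zero ≤? f (suc z)
...   | yes f₀≤ = zero , p₀ , λ { zero _ → ≤-refl ; (suc y) py → ≤-trans f₀≤ (min y py) }
...   | no  f₀≰ = suc z , pz , λ { zero _ → <⇒≤ (≰⇒> f₀≰) ; (suc y) py → min y py }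

module Ranking {n : ℕ} (key : Fin n → ℕ) where

  keyedBelow? : ∀ v u → Dec (key u < key v)
  keyedBelow? v u = key u <? key v

  keyedBelow : Fin n → Subset n
  keyedBelow v = satisfying (keyedBelow? v)

  ∣keyedBelow∣<n : ∀ v → ∣ keyedBelow v ∣ < n
  ∣keyedBelow∣<n v =
    subst (∣ keyedBelow v ∣ <_) (∣⊤∣≡n n) (≤-trans (s≤s below⊆) (x∈p⇒∣p-x∣<∣p∣ {x = v} {p = ⊤} ∈⊤))
    where
    below⊆ : ∣ keyedBelow v ∣ ≤ ∣ ⊤ - v ∣
    below⊆ = p⊆q⇒∣p∣≤∣q∣ {p = keyedBelow v} {q = ⊤ - v} λ {u} u∈ →
      x∈p∧x≢y⇒x∈p-y ∈⊤ λ { refl → <-irrefl refl (∈-satisfying⁻ (keyedBelow? v) u∈) }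

  rank : Fin n → Fin n
  rank v = fromℕ< (∣keyedBelow∣<n v)

  rank-mono : ∀ {u v} → key u < key v → rank u F.< rank v
  rank-mono {u} {v} ku<kv
    rewrite toℕ-fromℕ< (∣keyedBelow∣<n u) | toℕ-fromℕ< (∣keyedBelow∣<n v) =
    p⊂q⇒∣p∣<∣q∣ {p = keyedBelow u}
      ( (λ w∈ → ∈-satisfying⁺ (keyedBelow? v) (<-trans (∈-satisfying⁻ (keyedBelow? u) w∈) ku<kv))
      , u , ∈-satisfying⁺ (keyedBelow? v) ku<kv , λ u∈ → <-irrefl refl (∈-satisfying⁻ (keyedBelow? u) u∈))

  rank-reflects-≤ : ∀ {u v} → rank u F.< rank v → key u ≤ key v
  rank-reflects-≤ ru<rv = ≮⇒≥ λ kv<ku → <-asym ru<rv (rank-mono kv<ku)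

  rank-injective : Injective _≡_ _≡_ key → Injective _≡_ _≡_ rank
  rank-injective key-inj {u} {v} ru≡rv with <-cmp (key u) (key v)
  ... | tri< ku<kv _ _ = contradiction ru≡rv (FP.<⇒≢ (rank-mono ku<kv))
  ... | tri≈ _ ku≡kv _ = key-inj ku≡kv
  ... | tri> _ _ kv<ku = contradiction (sym ru≡rv) (FP.<⇒≢ (rank-mono kv<ku))

module Greedy {n m d : ℕ} (key : Fin n → Fin m) (C : Fin n → Subset n)
              (C-earlier : ∀ {a w} → a ∈ C w → key a F.< key w)
              (C-small : ∀ w → ∣ C w ∣ ≤ d) where

  colouringBelow : ∀ K → ∃ λ (c : Fin n → Fin (suc d)) →
                   ∀ {a w} → toℕ (key w) < K → a ∈ C w → c a ≢ c w
  colouringBelow zero = (λ _ → zero) , λ ()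
  colouringBelow (suc K) with colouringBelow K
  ... | c , c-proper = recolour , recolour-proper
    where
    recolour : Fin n → Fin (suc d)
    recolour v with toℕ (key v) ≟ℕ K
    ... | yes _ = proj₁ (freshColour c (C v) (s≤s (C-small v)))
    ... | no  _ = c v

    recolour-old : ∀ {v} → toℕ (key v) ≢ K → recolour v ≡ c v
    recolour-old {v} kv≢K with toℕ (key v) ≟ℕ K
    ... | yes kv≡K = contradiction kv≡K kv≢K
    ... | no  _    = refl

    earlier-key≢K : ∀ {a w} → toℕ (key w) < suc K → a ∈ C w → toℕ (key a) ≢ K
    earlier-key≢K kw≤K a∈C ka≡K = <-irrefl ka≡K (≤-trans (C-earlier a∈C) (≤-pred kw≤K))

    recolour-proper : ∀ {a w} → toℕ (key w) < suc K → a ∈ C w → recolour a ≢ recolour w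
    recolour-proper {a} {w} kw≤K a∈C
      rewrite recolour-old (earlier-key≢K kw≤K a∈C) with toℕ (key w) ≟ℕ K
    ... | yes _    = proj₂ (freshColour c (C w) (s≤s (C-small w))) a∈C
    ... | no  kw≢K = c-proper (≤∧≢⇒< (≤-pred kw≤K) kw≢K) a∈C

  greedyColouring : ∃ λ (c : Fin n → Fin (suc d)) → ∀ {a w} → a ∈ C w → c a ≢ c w
  greedyColouring with colouringBelow m
  ... | c , c-proper = c , λ {_} {w} → c-proper (toℕ<n (key w))

edge⇒≢ : (G : Graph) {u v : Fin (n G)} → Edge G u v → u ≢ v
edge⇒≢ G {u} e refl = subst T (irref G u) e

width0⇒edgeless : {G : Graph} (D : PathDecomposition G) → WidthAtMost D 0 →
                  ∀ u v → ¬ Edge G u v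
width0⇒edgeless {G} D narrow u v e with cover-e D u v e
... | i , u∈ , v∈ =
  contradiction (≤-trans (x,y∈p⇒2+∣p-x-y∣≤∣p∣ u∈ v∈ (edge⇒≢ G e)) (narrow i)) λ { (s≤s ()) }

edgeless⇒layout : {G : Graph} {s q : ℕ} → (∀ u v → ¬ Edge G u v) → SimultaneousLayout G s q
edgeless⇒layout {G} edgeless =
  identity , (partition , λ u v _ _ e _ _ _ _ _ → edgeless u v e)
           , (partition , λ u v _ _ e _ _ _ _ _ → edgeless u v e)
  where
  identity : VertexOrder G
  identity = record { pos = λ v → v ; pos-inj = λ eq → eq }
  partition : ∀ {k} → EdgePartition G k
  partition = record { colour     = λ u v e → ⊥-elim (edgeless u v e)
                     ; colour-sym = λ u v e _ → ⊥-elim (edgeless u v e) }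

module FirstBagOrder (G : Graph) (D : PathDecomposition G) where

  V : Set
  V = Fin (n G)

  opaque
    first : V → Fin (m D)
    first v = proj₁ (argmin toℕ (λ i → v ∈? bag D i) (cover-v D v))

    first-∈ : ∀ v → v ∈ bag D (first v)
    first-∈ v = proj₁ (proj₂ (argmin toℕ (λ i → v ∈? bag D i) (cover-v D v)))

    first-≤ : ∀ {v i} → v ∈ bag D i → first v F.≤ i
    first-≤ {v} {i} = proj₂ (proj₂ (argmin toℕ (λ i → v ∈? bag D i) (cover-v D v))) i

  ∈-first-between : ∀ {u w t} → first u F.≤ first w → first w F.≤ first t →
                    u ∈ bag D (first t) → u ∈ bag D (first w)
  ∈-first-between {u} {w} {t} u≤w w≤t =
    interval D u (first u) (first w) (first t) u≤w w≤t (first-∈ u)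

  edge⇒∈-first : ∀ {u v} → Edge G u v → first u F.≤ first v → u ∈ bag D (first v)
  edge⇒∈-first {u} {v} e u≤v with cover-e D u v e
  ... | i , u∈ , v∈ = interval D u (first u) (first v) i u≤v (first-≤ v∈) (first-∈ u) u∈

  key : V → ℕ
  key v = toℕ (combine (first v) v)

  key-injective : Injective _≡_ _≡_ key
  key-injective {u} {v} eq = combine-injectiveʳ (first u) u (first v) v (toℕ-injective eq)

  open Ranking key

  σ : VertexOrder G
  σ = record { pos = rank ; pos-inj = rank-injective key-injective }

  _<σ?_ : ∀ u v → Dec (u <[ σ ] v)
  u <σ? v = rank u FP.<? rank v

  <σ⇒≢ : ∀ {u v} → u <[ σ ] v → u ≢ v
  <σ⇒≢ u<v refl = FP.<-irrefl refl u<v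

  first-mono : ∀ {u v} → u <[ σ ] v → first u F.≤ first v
  first-mono {u} {v} u<v = ≮⇒≥ λ fv<fu →
    <⇒≱ (combine-monoˡ-< v u fv<fu) (rank-reflects-≤ u<v)

  -- When no vertex follows w, next w defaults to w, which leaves w without conflicts.
  opaque
    next : V → V
    next w with any? (w <σ?_)
    ... | yes later = proj₁ (argmin (toℕ ∘ first) (w <σ?_) later)
    ... | no  _     = w

    next-spec : ∀ {w y} → w <[ σ ] y → w <[ σ ] next w × first (next w) F.≤ first y
    next-spec {w} {y} w<y with any? (w <σ?_)
    ... | yes later = let _ , w<z , min = argmin (toℕ ∘ first) (w <σ?_) later in w<z , min y w<y
    ... | no  none  = contradiction (y , w<y) none

  nextBag : V → Subset (n G)
  nextBag w = bag D (first (next w))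

  Conflict : V → V → Set
  Conflict w a = a <[ σ ] w × w <[ σ ] next w × a ∈ nextBag w × w ∈ nextBag w

  conflict? : ∀ w a → Dec (Conflict w a)
  conflict? w a = a <σ? w ×-dec w <σ? next w ×-dec a ∈? nextBag w ×-dec w ∈? nextBag w

  conflicts : V → Subset (n G)
  conflicts w = satisfying (conflict? w)

  conflict : ∀ {a w t} → a <[ σ ] w → w <[ σ ] t →
             a ∈ bag D (first t) → w ∈ bag D (first t) → Conflict w a
  conflict a<w w<t a∈ w∈ with next-spec w<t
  ... | w<z , z≤t =
    a<w , w<z , ∈-first-between (FP.≤-trans (first-mono a<w) (first-mono w<z)) z≤t a∈
              , ∈-first-between (first-mono w<z) z≤t w∈

  conflicts-earlier : ∀ {a w} → a ∈ conflicts w → a <[ σ ] w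
  conflicts-earlier {w = w} a∈ = proj₁ (∈-satisfying⁻ (conflict? w) a∈)

  module _ {d : ℕ} (narrow : WidthAtMost D (suc d)) where

    conflicts-small : ∀ w → ∣ conflicts w ∣ ≤ d
    conflicts-small w with w <σ? next w ×-dec w ∈? nextBag w
    ... | yes (w<z , w∈) = ≤-pred (≤-pred (begin
      suc (suc ∣ conflicts w ∣)            ≤⟨ s≤s (s≤s (p⊆q⇒∣p∣≤∣q∣ {p = conflicts w} conflicts⊆)) ⟩
      suc (suc ∣ nextBag w - w - next w ∣) ≤⟨ x,y∈p⇒2+∣p-x-y∣≤∣p∣ {p = nextBag w}
                                                w∈ (first-∈ (next w)) (<σ⇒≢ w<z) ⟩
      ∣ nextBag w ∣                        ≤⟨ narrow (first (next w)) ⟩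
      suc (suc d)                          ∎))
      where
      open ≤-Reasoning
      conflicts⊆ : conflicts w ⊆ nextBag w - w - next w
      conflicts⊆ a∈ with ∈-satisfying⁻ (conflict? w) a∈
      ... | a<w , _ , a∈B , _ = x∈p∧x≢y⇒x∈p-y (x∈p∧x≢y⇒x∈p-y a∈B (<σ⇒≢ a<w))
                                               (<σ⇒≢ (FP.<-trans a<w w<z))
    ... | no ¬shared =
      ≤-trans (p⊆q⇒∣p∣≤∣q∣ {p = conflicts w} conflicts⊆⊥) (≤-trans (≤-reflexive (∣⊥∣≡0 (n G))) z≤n)
      where
      conflicts⊆⊥ : conflicts w ⊆ ⊥
      conflicts⊆⊥ a∈ with ∈-satisfying⁻ (conflict? w) a∈
      ... | _ , w<z , _ , w∈ = contradiction (w<z , w∈) ¬shared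

    open Greedy rank conflicts conflicts-earlier conflicts-small

    c : V → Fin (suc d)
    c = proj₁ greedyColouring

    c-separates : ∀ {w a} → Conflict w a → c a ≢ c w
    c-separates {w = w} conf = proj₂ greedyColouring (∈-satisfying⁺ (conflict? w) conf)

    leftEnd : V → V → V
    leftEnd u v with u <σ? v
    ... | yes _ = u
    ... | no  _ = v

    leftEnd-< : ∀ {u v} → u <[ σ ] v → leftEnd u v ≡ u
    leftEnd-< {u} {v} u<v with u <σ? v
    ... | yes _   = refl
    ... | no  u≮v = contradiction u<v u≮v

    leftEnd-comm : ∀ {u v} → u ≢ v → leftEnd u v ≡ leftEnd v u
    leftEnd-comm {u} {v} u≢v with u <σ? v | v <σ? u
    ... | yes u<v | yes v<u = contradiction v<u (FP.<-asym u<v)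
    ... | yes _   | no  _   = refl
    ... | no  _   | yes _   = refl
    ... | no  u≮v | no  v≮u =
      contradiction (pos-inj σ (FP.≤-antisym (≮⇒≥ v≮u) (≮⇒≥ u≮v))) u≢v

    partition : EdgePartition G (suc d)
    partition = record
      { colour     = λ u v _ → c (leftEnd u v)
      ; colour-sym = λ u v e _ → cong c (leftEnd-comm (edge⇒≢ G e)) }

    sameColour⇒c≡ : ∀ {u v x y} (e : Edge G u v) (f : Edge G x y) →
                    u <[ σ ] v → x <[ σ ] y →
                    colour partition u v e ≡ colour partition x y f → c u ≡ c x
    sameColour⇒c≡ _ _ u<v x<y eq =
      trans (cong c (sym (leftEnd-< u<v))) (trans eq (cong c (leftEnd-< x<y)))

    nonCrossing : NonCrossing σ partition
    nonCrossing u v x y e f u<x x<v v<y sameColour =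
      c-separates (conflict u<x x<v (edge⇒∈-first e (first-mono u<v)) x∈)
                  (sameColour⇒c≡ e f u<v x<y sameColour)
      where
      u<v : u <[ σ ] v
      u<v = FP.<-trans u<x x<v
      x<y : x <[ σ ] y
      x<y = FP.<-trans x<v v<y
      x∈ : x ∈ bag D (first v)
      x∈ = ∈-first-between (first-mono x<v) (first-mono v<y) (edge⇒∈-first f (first-mono x<y))

    nonNested : NonNested σ partition
    nonNested u v x y e f u<x x<y y<v sameColour =
      c-separates (conflict u<x x<y u∈ (edge⇒∈-first f (first-mono x<y)))
                  (sameColour⇒c≡ e f u<v x<y sameColour)
      where
      u<y : u <[ σ ] y
      u<y = FP.<-trans u<x x<y
      u<v : u <[ σ ] v
      u<v = FP.<-trans u<y y<v
      u∈ : u ∈ bag D (first y)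
      u∈ = ∈-first-between (first-mono u<y) (first-mono y<v) (edge⇒∈-first e (first-mono u<v))

    layout : SimultaneousLayout G (suc d) (suc d)
    layout = σ , (partition , nonCrossing) , (partition , nonNested)

lemma2 : (G : Graph) (p : ℕ) → HasPathwidth G p → SimultaneousLayout G p p
lemma2 G zero    ((D , narrow) , _) = edgeless⇒layout (width0⇒edgeless D narrow)
lemma2 G (suc d) ((D , narrow) , _) = FirstBagOrder.layout G D narrow
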